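{- If $G$ is a bridgeless connected graph of order $n$ with diameter $2$, then $trc(G)\leq n-1$.
   Context: All graphs are finite, simple and undirected. A total-coloring assigns colors to all vertices and edges; a path is total-rainbow if its edges and internal vertices receive pairwise distinct colors; $trc(G)$ is the minimum number of colors in a total-coloring of the connected graph $G$ such that every two distinct vertices are joined by a total-rainbow path. -}

module Defs where

open import Data.Nat using (ℕ; _≤_; _∸_)
open import Data.Bool using (Bool; false; T; _∧_; _∨_; not)
open import Data.Fin using (Fin; _≟_)
open import Data.List using (List; []; _∷_; length)
open import Data.List.Relation.Unary.Unique.Propositional using (Unique)
open import Data.Product using (Σ; ∃; ∃-syntax; _×_; _,_)
open import Data.Unit using (⊤)
open import Relation.Nullary using (¬_; ⌊_⌋)
open import Relation.Binary.PropositionalEquality using (_≡_; _≢_)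

Adjacency : ℕ → Set
Adjacency n = Fin n → Fin n → Bool

record Graph (n : ℕ) : Set where
  field
    adj     : Adjacency n
    adj-sym : ∀ u v → adj u v ≡ adj v u
    irrefl  : ∀ u → adj u u ≡ false
open Graph public

-- A walk starting at u, listed by its subsequent vertices.
IsWalk : ∀ {n} → Adjacency n → Fin n → List (Fin n) → Set
IsWalk a u []       = ⊤
IsWalk a u (x ∷ xs) = T (a u x) × IsWalk a x xs

lastV : ∀ {n} → Fin n → List (Fin n) → Fin n
lastV u []       = u
lastV u (x ∷ xs) = lastV x xs

DistLe : ∀ {n} → Adjacency n → Fin n → Fin n → ℕ → Set
DistLe a u v k = ∃[ xs ] (IsWalk a u xs × lastV u xs ≡ v × length xs ≤ k)

Connected : ∀ {n} → Adjacency n → Set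
Connected a = ∀ u v → ∃[ xs ] (IsWalk a u xs × lastV u xs ≡ v)

-- Diameter exactly d: all distances ≤ d, and some distance is not ≤ d - 1.
-- (For d ≥ 1; used here with d = 2.)
HasDiameter : ∀ {n} → Adjacency n → ℕ → Set
HasDiameter a d =
  (∀ u v → DistLe a u v d) × (∃[ u ] ∃[ v ] ¬ DistLe a u v (d ∸ 1))

deleteEdge : ∀ {n} → Adjacency n → Fin n → Fin n → Adjacency n
deleteEdge a u v x y =
  a x y ∧ not ((⌊ x ≟ u ⌋ ∧ ⌊ y ≟ v ⌋) ∨ (⌊ x ≟ v ⌋ ∧ ⌊ y ≟ u ⌋))

-- Bridgeless: no edge whose removal disconnects the graph
-- (G is assumed connected alongside).
Bridgeless : ∀ {n} → Graph n → Set
Bridgeless G = ∀ u v → T (adj G u v) → Connected (deleteEdge (adj G) u v)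

-- A total-coloring with colors Fin k: colors on vertices and on edges
-- (edge colour given by a symmetric function; only values on edges matter).
record TotalColoring (n k : ℕ) : Set where
  field
    vcol     : Fin n → Fin k
    ecol     : Fin n → Fin n → Fin k
    ecol-sym : ∀ u v → ecol u v ≡ ecol v u
open TotalColoring public

pathColors : ∀ {n k} → TotalColoring n k → Fin n → List (Fin n) → List (Fin k)
pathColors c u []           = []
pathColors c u (x ∷ [])     = ecol c u x ∷ []
pathColors c u (x ∷ y ∷ ys) = ecol c u x ∷ vcol c x ∷ pathColors c x (y ∷ ys)

TotalRainbowPath : ∀ {n k} → Adjacency n → TotalColoring n k → Fin n → Fin n → Set
TotalRainbowPath a c u v =
  ∃[ xs ] (IsWalk a u xs × lastV u xs ≡ v × Unique (u ∷ xs) × Unique (pathColors c u xs))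

TotalRainbowConnected : ∀ {n k} → Adjacency n → TotalColoring n k → Set
TotalRainbowConnected a c = ∀ u v → u ≢ v → TotalRainbowPath a c u v

TrcLe : ∀ {n} → Graph n → ℕ → Set
TrcLe {n} G k = Σ (TotalColoring n k) (TotalRainbowConnected (adj G))

-- Give the n vertices labels in Fin (n − 1) that are injective
-- except on the ends p, q of one chosen edge, which share a label.  Colour
-- the edge uv with L u ⊕ L v (addition modulo n − 1) and the vertex w with
-- L w ⊕ L (t w), where t w is a "partner" of w.  Adjacent vertices are joined
-- by their edge; a non-adjacent pair u, v is joined through a common
-- neighbour w, and the three colours L w ⊕ L u, L w ⊕ L (t w), L w ⊕ L v
-- are distinct as soon as the labels L u, L (t w), L v are.  This holds when
-- the hub w is "good": t w lies outside {p, q} and is not adjacent to w.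
--
-- Choose q at
-- distance 2 from some z.  If some neighbour p of q has a non-neighbour
-- outside {p, q}, partners can be chosen for every vertex and the hubs are
-- the common neighbours given by diameter 2.  Otherwise the neighbours of q
-- are universal vertices, bridgelessness gives q two of them, and one of
-- them serves as the hub for every pair.
module Submission where

open import Defs
open import Data.Nat using (ℕ; zero; suc; _+_; _*_; _∸_; _≤_; _<_; z≤n; s≤s; NonZero)
open import Data.Nat.Properties
  using (+-comm; +-assoc; +-identityʳ; +-∸-comm; m∸[m∸n]≡n; m+[n∸m]≡n; m∸n≤m; ≤-<-trans; ≤-total)
open import Data.Nat.DivMod using (_%_; _/_; _mod_; m%n≡m∸m/n*n; m/n*n≤m; m%n≤m; m%n<n)
open import Data.Nat.Divisibility using (_∣_; divides; ∣m+n∣m⇒∣n; >⇒∤)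
open import Data.Bool using (true; false; T)
open import Data.Fin using (Fin; toℕ; fromℕ<; punchOut; _≟_)
open import Data.Fin.Properties using (toℕ-injective; toℕ-fromℕ<; toℕ<n; punchOut-injective; any?)
open import Data.List using ([]; _∷_)
open import Data.List.Relation.Unary.All using ([]; _∷_)
open import Data.List.Relation.Unary.AllPairs using ([]; _∷_)
open import Data.List.Relation.Unary.Unique.Propositional using (Unique)
open import Data.Product using (∃-syntax; _×_; _,_; proj₁)
open import Data.Sum using (_⊎_; inj₁; inj₂)
open import Data.Unit using (tt)
open import Data.Empty using (⊥-elim)
open import Function using (_∘_; id)
open import Relation.Nullary using (¬_; Dec; yes; no; contradiction)
open import Relation.Nullary.Decidable using (T?; ¬?; _×-dec_)
open import Relation.Binary.PropositionalEquality
  using (_≡_; _≢_; refl; sym; trans; cong; subst; module ≡-Reasoning)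

open ≡-Reasoning

n∣m∸m%n : ∀ m n .{{_ : NonZero n}} → n ∣ m ∸ m % n
n∣m∸m%n m n = divides (m / n) (begin
  m ∸ m % n            ≡⟨ cong (m ∸_) (m%n≡m∸m/n*n m n) ⟩
  m ∸ (m ∸ m / n * n)  ≡⟨ m∸[m∸n]≡n (m/n*n≤m m n) ⟩
  m / n * n            ∎)

[m+d]%n≡m%n⇒d≡0 : ∀ m d n .{{_ : NonZero n}} → d < n → (m + d) % n ≡ m % n → d ≡ 0
[m+d]%n≡m%n⇒d≡0 m zero    n d<n eq = refl
[m+d]%n≡m%n⇒d≡0 m (suc d) n d<n eq = contradiction n∣d (>⇒∤ d<n)
  where
  difference : m + suc d ∸ (m + suc d) % n ≡ (m ∸ m % n) + suc d
  difference = trans (cong (m + suc d ∸_) eq) (+-∸-comm (suc d) (m%n≤m m n))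

  n∣d : n ∣ suc d
  n∣d = ∣m+n∣m⇒∣n (subst (n ∣_) difference (n∣m∸m%n (m + suc d) n)) (n∣m∸m%n m n)

+-%-cancelˡ-≤ : ∀ a {b c} n .{{_ : NonZero n}} →
                b ≤ c → c < n → (a + b) % n ≡ (a + c) % n → b ≡ c
+-%-cancelˡ-≤ a {b} {c} n b≤c c<n eq = begin
  b                ≡⟨ sym (+-identityʳ b) ⟩
  b + 0            ≡⟨ cong (b +_) (sym gap≡0) ⟩
  b + (c ∸ b)      ≡⟨ m+[n∸m]≡n b≤c ⟩
  c                ∎
  where
  shifted : (a + b + (c ∸ b)) % n ≡ (a + b) % n
  shifted = begin
    (a + b + (c ∸ b)) % n    ≡⟨ cong (_% n) (+-assoc a b (c ∸ b)) ⟩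
    (a + (b + (c ∸ b))) % n  ≡⟨ cong (λ x → (a + x) % n) (m+[n∸m]≡n b≤c) ⟩
    (a + c) % n              ≡⟨ sym eq ⟩
    (a + b) % n              ∎

  gap≡0 : c ∸ b ≡ 0
  gap≡0 = [m+d]%n≡m%n⇒d≡0 (a + b) (c ∸ b) n (≤-<-trans (m∸n≤m c b) c<n) shifted

+-%-cancelˡ : ∀ a {b c} n .{{_ : NonZero n}} →
              b < n → c < n → (a + b) % n ≡ (a + c) % n → b ≡ c
+-%-cancelˡ a {b} {c} n b<n c<n eq with ≤-total b c
... | inj₁ b≤c = +-%-cancelˡ-≤ a n b≤c c<n eq
... | inj₂ c≤b = sym (+-%-cancelˡ-≤ a n c≤b b<n (sym eq))

_⊕_ : ∀ {m} .{{_ : NonZero m}} → Fin m → Fin m → Fin m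
_⊕_ {m} i j = (toℕ i + toℕ j) mod m

⊕-comm : ∀ {m} .{{_ : NonZero m}} (i j : Fin m) → i ⊕ j ≡ j ⊕ i
⊕-comm {m} i j = cong (λ x → fromℕ< (m%n<n x m)) (+-comm (toℕ i) (toℕ j))

⊕-cancelˡ : ∀ {m} .{{_ : NonZero m}} (i : Fin m) {j k : Fin m} → i ⊕ j ≡ i ⊕ k → j ≡ k
⊕-cancelˡ {m} i {j} {k} eq = toℕ-injective (+-%-cancelˡ (toℕ i) m (toℕ<n j) (toℕ<n k) residues)
  where
  residues : (toℕ i + toℕ j) % m ≡ (toℕ i + toℕ k) % m
  residues = begin
    (toℕ i + toℕ j) % m  ≡⟨ sym (toℕ-fromℕ< (m%n<n (toℕ i + toℕ j) m)) ⟩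
    toℕ (i ⊕ j)          ≡⟨ cong toℕ eq ⟩
    toℕ (i ⊕ k)          ≡⟨ toℕ-fromℕ< (m%n<n (toℕ i + toℕ k) m) ⟩
    (toℕ i + toℕ k) % m  ∎

module Merge {k : ℕ} {p q : Fin (suc k)} (q≢p : q ≢ p) where

  merge : Fin (suc k) → Fin k
  merge x with q ≟ x
  ... | yes _   = punchOut q≢p
  ... | no  q≢x = punchOut q≢x

  merge-fibres : ∀ {x y} → merge x ≡ merge y →
                 x ≡ y ⊎ (x ≡ p × y ≡ q) ⊎ (x ≡ q × y ≡ p)
  merge-fibres {x} {y} eq with q ≟ x | q ≟ y
  ... | yes refl | yes refl = inj₁ refl
  ... | yes refl | no  q≢y  = inj₂ (inj₂ (refl , sym (punchOut-injective q≢p q≢y eq)))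
  ... | no  q≢x  | yes refl = inj₂ (inj₁ (punchOut-injective q≢x q≢p eq , refl))
  ... | no  q≢x  | no  q≢y  = inj₁ (punchOut-injective q≢x q≢y eq)

module _ {n : ℕ} (G : Graph n) where

  adj⇒≢ : ∀ {u v} → T (adj G u v) → u ≢ v
  adj⇒≢ {u} uv refl = subst T (irrefl G u) uv

  adj-flip : ∀ {u v} → T (adj G u v) → T (adj G v u)
  adj-flip {u} {v} = subst T (adj-sym G u v)

  non-loop : ∀ w → ¬ T (adj G w w)
  non-loop w = subst T (irrefl G w)

far⇒distinct-nonadjacent : ∀ {n} {a : Adjacency n} {u v} →
                           ¬ DistLe a u v 1 → u ≢ v × ¬ T (a u v)
far⇒distinct-nonadjacent {v = v} far =
  (λ { refl → far ([] , tt , refl , z≤n) }) ,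
  (λ uv → far ((v ∷ []) , (uv , tt) , refl , s≤s z≤n))

commonNeighbour : ∀ {n} {a : Adjacency n} → (∀ u v → DistLe a u v 2) →
                  ∀ {u v} → u ≢ v → ¬ T (a u v) → ∃[ w ] (T (a u w) × T (a w v))
commonNeighbour diam {u} {v} u≢v ¬uv with diam u v
... | [] , _ , u≡v , _                        = ⊥-elim (u≢v u≡v)
... | (_ ∷ []) , (uv , _) , refl , _          = ⊥-elim (¬uv uv)
... | (w ∷ _ ∷ []) , (uw , wv , _) , refl , _ = w , uw , wv
... | (_ ∷ _ ∷ _ ∷ _) , _ , _ , s≤s (s≤s ())

deleteEdge-⊆ : ∀ {n} (a : Adjacency n) u v x y →
               T (deleteEdge a u v x y) → T (a x y) × ¬ (x ≡ u × y ≡ v)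
deleteEdge-⊆ a u v x y h with a x y | x ≟ u | y ≟ v
... | false | _       | _       = ⊥-elim h
... | true  | no  x≢u | _       = tt , λ (x≡u , _) → x≢u x≡u
... | true  | yes _   | no  y≢v = tt , λ (_ , y≡v) → y≢v y≡v
... | true  | yes _   | yes _   = ⊥-elim h

-- In a bridgeless graph the end q of an edge qp has a second neighbour:
-- a path from q to p avoiding the edge qp must leave q along another edge.
secondNeighbour : ∀ {n} (G : Graph n) → Bridgeless G →
                  ∀ {q p} → T (adj G q p) → ∃[ w ] (T (adj G q w) × w ≢ p)
secondNeighbour G bridgeless {q} {p} qp with bridgeless q p qp q p
... | [] , _ , q≡p           = ⊥-elim (adj⇒≢ G qp q≡p)
... | (w ∷ _) , (qw , _) , _ with deleteEdge-⊆ (adj G) q p q w qw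
...   | qw′ , not-qp = w , qw′ , λ w≡p → not-qp (refl , w≡p)

module InducedColouring {n m : ℕ} .{{_ : NonZero m}} (G : Graph n)
                        (L : Fin n → Fin m) (t : Fin n → Fin n) where

  colouring : TotalColoring n m
  colouring = record
    { vcol     = λ w → L w ⊕ L (t w)
    ; ecol     = λ u v → L u ⊕ L v
    ; ecol-sym = λ u v → ⊕-comm (L u) (L v)
    }

  distinct₃ : ∀ {A : Set} {a b c : A} → a ≢ b → a ≢ c → b ≢ c → Unique (a ∷ b ∷ c ∷ [])
  distinct₃ a≢b a≢c b≢c = (a≢b ∷ a≢c ∷ []) ∷ (b≢c ∷ []) ∷ [] ∷ []

  edgePath : ∀ {u v} → T (adj G u v) → TotalRainbowPath (adj G) colouring u v
  edgePath {v = v} uv = (v ∷ []) , (uv , tt) , refl , ((adj⇒≢ G uv ∷ []) ∷ [] ∷ []) , ([] ∷ [])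

  -- The path u w v is total-rainbow when L u, L (t w), L v are distinct,
  -- since its colours are L w ⊕ L u, L w ⊕ L (t w), L w ⊕ L v up to ⊕-comm.
  twoPath : ∀ {u w v} → T (adj G u w) → T (adj G w v) → u ≢ v →
            L u ≢ L v → L u ≢ L (t w) → L (t w) ≢ L v →
            TotalRainbowPath (adj G) colouring u v
  twoPath {u} {w} {v} uw wv u≢v Lu≢Lv Lu≢Lt Lt≢Lv =
    (w ∷ v ∷ []) , (uw , wv , tt) , refl ,
    distinct₃ (adj⇒≢ G uw) u≢v (adj⇒≢ G wv) ,
    distinct₃ (Lu≢Lt ∘ cancel-u) (Lu≢Lv ∘ cancel-u) (Lt≢Lv ∘ ⊕-cancelˡ (L w))
    where
    cancel-u : ∀ {i} → L u ⊕ L w ≡ L w ⊕ i → L u ≡ i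
    cancel-u eq = ⊕-cancelˡ (L w) (trans (⊕-comm (L w) (L u)) eq)

module HubColouring {k : ℕ} (G : Graph (suc (suc k))) {p q : Fin (suc (suc k))}
                    (qp : T (adj G q p)) (t : Fin (suc (suc k)) → Fin (suc (suc k))) where

  open Merge (adj⇒≢ G qp)
  open InducedColouring G merge t

  Good : Fin (suc (suc k)) → Set
  Good w = t w ≢ p × t w ≢ q × ¬ T (adj G w (t w))

  -- Only the adjacent pair p, q shares a label.
  nonadjacent-labels : ∀ {u v} → u ≢ v → ¬ T (adj G u v) → merge u ≢ merge v
  nonadjacent-labels u≢v ¬uv eq with merge-fibres eq
  ... | inj₁ u≡v                  = u≢v u≡v
  ... | inj₂ (inj₁ (refl , refl)) = ¬uv (adj-flip G qp)
  ... | inj₂ (inj₂ (refl , refl)) = ¬uv qp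

  partner-label : ∀ {u w} → Good w → T (adj G u w) → merge u ≢ merge (t w)
  partner-label (t≢p , t≢q , ¬wt) uw eq with merge-fibres eq
  ... | inj₁ refl             = ¬wt (adj-flip G uw)
  ... | inj₂ (inj₁ (_ , t≡q)) = t≢q t≡q
  ... | inj₂ (inj₂ (_ , t≡p)) = t≢p t≡p

  trc-from-hubs : (∀ {u v} → u ≢ v → ¬ T (adj G u v) →
                   ∃[ w ] (T (adj G u w) × T (adj G w v) × Good w)) →
                  TrcLe G (suc k)
  trc-from-hubs hubs = colouring , connect
    where
    connect : TotalRainbowConnected (adj G) colouring
    connect u v u≢v with T? (adj G u v)
    ... | yes uv = edgePath uv
    ... | no ¬uv with hubs u≢v ¬uv
    ...   | w , uw , wv , good =
      twoPath uw wv u≢v (nonadjacent-labels u≢v ¬uv) (partner-label good uw)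
              (λ eq → partner-label good (adj-flip G wv) (sym eq))

trc-anchored : ∀ {k} (G : Graph (suc (suc k))) → (∀ u v → DistLe (adj G) u v 2) →
               ∀ {p q x z} → T (adj G q p) → z ≢ q → ¬ T (adj G q z) →
               x ≢ p → x ≢ q → ¬ T (adj G p x) → TrcLe G (suc k)
trc-anchored {k} G diam {p} {q} {x} {z} qp z≢q ¬qz x≢p x≢q ¬px = trc-from-hubs hubs
  where
  partner : Fin (suc (suc k)) → Fin (suc (suc k))
  partner w with w ≟ p | w ≟ q
  ... | yes _ | _     = x
  ... | no _  | yes _ = z
  ... | no _  | no _  = w

  open HubColouring G qp partner

  z≢p : z ≢ p
  z≢p refl = ¬qz qp

  good : ∀ w → Good w
  good w with w ≟ p | w ≟ q
  ... | yes refl | _        = x≢p , x≢q , ¬px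
  ... | no _     | yes refl = z≢p , z≢q , ¬qz
  ... | no w≢p   | no w≢q   = w≢p , w≢q , non-loop G w

  hubs : ∀ {u v} → u ≢ v → ¬ T (adj G u v) →
         ∃[ w ] (T (adj G u w) × T (adj G w v) × Good w)
  hubs u≢v ¬uv with commonNeighbour diam u≢v ¬uv
  ... | w , uw , wv = w , uw , wv , good w

trc-universal : ∀ {k} (G : Graph (suc (suc k))) → ∀ {p q w} → T (adj G q p) →
                w ≢ p → w ≢ q → (∀ x → x ≢ w → T (adj G w x)) → TrcLe G (suc k)
trc-universal G {w = w} qp w≢p w≢q universal = trc-from-hubs hubs
  where
  open HubColouring G qp id

  hubs : ∀ {u v} → u ≢ v → ¬ T (adj G u v) →
         ∃[ w ] (T (adj G u w) × T (adj G w v) × Good w)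
  hubs {u} {v} u≢v ¬uv =
    w , adj-flip G (universal u u≢w) , universal v v≢w , w≢p , w≢q , non-loop G w
    where
    u≢w : u ≢ w
    u≢w refl = ¬uv (universal v (u≢v ∘ sym))
    v≢w : v ≢ w
    v≢w refl = ¬uv (adj-flip G (universal u u≢v))

Anchored : ∀ {n} → Graph n → Fin n → Set
Anchored G q = ∃[ p ] (T (adj G q p) × ∃[ x ] (x ≢ p × x ≢ q × ¬ T (adj G p x)))

anchored? : ∀ {n} (G : Graph n) q → Dec (Anchored G q)
anchored? G q = any? λ p → T? (adj G q p) ×-dec
                  any? λ x → ¬? (x ≟ p) ×-dec ¬? (x ≟ q) ×-dec ¬? (T? (adj G p x))

unanchored⇒universal : ∀ {n} (G : Graph n) {q w} → ¬ Anchored G q →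
                       T (adj G q w) → ∀ x → x ≢ w → T (adj G w x)
unanchored⇒universal G {q} {w} ¬anchored qw x x≢w with x ≟ q | T? (adj G w x)
... | yes refl | _      = adj-flip G qw
... | no _     | yes wx = wx
... | no x≢q   | no ¬wx = ⊥-elim (¬anchored (w , qw , x , x≢w , x≢q , ¬wx))

-- Theorem 4.1.
theorem4p1 : (n : ℕ) (G : Graph n) → Connected (adj G) → Bridgeless G →
    HasDiameter (adj G) 2 → TrcLe G (n ∸ 1)
theorem4p1 zero          G _ _ (_ , () , _)
theorem4p1 (suc zero)    G _ _ (_ , Fin.zero , Fin.zero , far) =
  ⊥-elim (proj₁ (far⇒distinct-nonadjacent far) refl)
  where import Data.Fin as Fin
theorem4p1 (suc (suc k)) G _ bridgeless (diam , q , z , far)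
  with far⇒distinct-nonadjacent far | anchored? G q
... | q≢z , ¬qz | yes (p , qp , x , x≢p , x≢q , ¬px) =
  trc-anchored G diam qp (q≢z ∘ sym) ¬qz x≢p x≢q ¬px
... | q≢z , ¬qz | no ¬anchored =
  let p , qp , _   = commonNeighbour diam q≢z ¬qz
      w , qw , w≢p = secondNeighbour G bridgeless qp
  in trc-universal G qp w≢p (adj⇒≢ G qw ∘ sym) (unanchored⇒universal G ¬anchored qw)
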